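{- Let $N$ be a prime, and for each $r\in\mathbb{Z}$ with $2\le|r|<\frac12N$, let $\gamma_{r,1}\in\Gamma_0(N)$ be a matrix with top row $\left(\begin{smallmatrix} r&-1\end{smallmatrix}\right)$. Then any matrix $\left(\begin{smallmatrix} A & B \\ CN & D \end{smallmatrix}\right) \in \Gamma_0(N)$ may be written in the form $\pm\tau_1\tau_2\cdots\tau_l$ with $\tau_i\in\{T,T^{ -1},W,W^{ -1},\gamma_{r,1}^{ -1}:2\le|r|<\frac12N\}$ for each $i=1,\ldots,l$, in such a way that $$ \#\{i:\tau_i\in\{\gamma_{r,1}^{ -1}\}\}\le\log_2(|A|). $$
   Context: $T=\left(\begin{smallmatrix} 1&1\\0&1\end{smallmatrix}\right)$ and $W=\left(\begin{smallmatrix} 1&0\\ N&1\end{smallmatrix}\right)$. -}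

module Defs where

open import Data.Nat using (ℕ) renaming (_≤_ to _≤ℕ_; _<_ to _<ℕ_; _*_ to _*ℕ_)
open import Data.Integer using (ℤ; +_; _+_; _*_; -_; _-_; ∣_∣)
open import Data.Integer.Divisibility using (_∣_)
open import Data.List using (List; []; _∷_; foldr; filter; length)
open import Data.Product using (_×_)
open import Relation.Binary.PropositionalEquality using (_≡_)

record Mat : Set where
  constructor mat
  field
    a b c d : ℤ
open Mat public

det : Mat → ℤ
det (mat a b c d) = a * d - b * c

_·_ : Mat → Mat → Mat
mat a b c d · mat a' b' c' d' =
  mat (a * a' + b * c') (a * b' + b * d') (c * a' + d * c') (c * b' + d * d')

I₂ : Mat
I₂ = mat (+ 1) (+ 0) (+ 0) (+ 1)

neg : Mat → Mat
neg (mat a b c d) = mat (- a) (- b) (- c) (- d)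

-- inverse of a determinant-1 matrix (the adjugate)
inv : Mat → Mat
inv (mat a b c d) = mat d (- b) (- c) a

InΓ₀ : ℕ → Mat → Set
InΓ₀ N M = (det M ≡ + 1) × ((+ N) ∣ c M)

Tm Tinv : Mat
Tm   = mat (+ 1) (+ 1) (+ 0) (+ 1)
Tinv = mat (+ 1) (Data.Integer.-[1+_] 0) (+ 0) (+ 1)

Wm Winv : ℕ → Mat
Wm N   = mat (+ 1) (+ 0) (+ N) (+ 1)
Winv N = mat (+ 1) (+ 0) (- (+ N)) (+ 1)

-- admissible r : 2 ≤ |r| < N/2  (i.e. 2|r| < N)
Admissible : ℕ → ℤ → Set
Admissible N r = (2 ≤ℕ ∣ r ∣) × (2 *ℕ ∣ r ∣ <ℕ N)

data Letter (N : ℕ) : Set where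
  T⁺ T⁻ W⁺ W⁻ : Letter N
  γ⁻ : (r : ℤ) → Admissible N r → Letter N

letterMat : (N : ℕ) → (ℤ → Mat) → Letter N → Mat
letterMat N γ T⁺ = Tm
letterMat N γ T⁻ = Tinv
letterMat N γ W⁺ = Wm N
letterMat N γ W⁻ = Winv N
letterMat N γ (γ⁻ r _) = inv (γ r)

evalWord : (N : ℕ) → (ℤ → Mat) → List (Letter N) → Mat
evalWord N γ = foldr (λ τ M → letterMat N γ τ · M) I₂

countγ : {N : ℕ} → List (Letter N) → ℕ
countγ [] = 0
countγ (T⁺ ∷ w) = countγ w
countγ (T⁻ ∷ w) = countγ w
countγ (W⁺ ∷ w) = countγ w
countγ (W⁻ ∷ w) = countγ w
countγ (γ⁻ _ _ ∷ w) = Data.Nat.suc (countγ w)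

module Submission where

-- The proof is a Euclidean algorithm on the first column, with nearest-integer
-- ("symmetric") division, run by induction on |A|:
--   1. Left-multiplying by a power of W^{-1} replaces C by its symmetric
--      remainder modulo A, so afterwards 2|CN| ≤ |A|N.
--   2. If now C = 0, the matrix is ±T^{±B}.
--   3. Otherwise divide CN = rA + s symmetrically.  If |r| ≥ 2, the bound on
--      CN forces 2|r| < N (here primality excludes 2|r| = N), so γ_{r,1} is
--      available and γ_{r,1}M has top-left entry -s with 2|s| ≤ |A|: one γ
--      letter is paid for by halving |A|.  If |r| ≤ 1, then |CN| ≤ 3|A|/2 and
--      dividing A by CN with a power of T shrinks |A| at no cost.

open import Defs
open import Data.Nat using (ℕ; _≤_; _^_)
open import Data.Nat.Primality using (Prime)
open import Data.Integer using (ℤ; +_; -_; ∣_∣)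
open import Data.List using (List)
open import Data.Product using (_×_; ∃; ∃-syntax)
open import Data.Sum using (_⊎_)
open import Relation.Binary.PropositionalEquality using (_≡_)

open import Data.Nat using (suc; s≤s; _<_; _∸_; _≤?_; NonZero; >-nonZero; >-nonZero⁻¹)
  renaming (_+_ to _+ℕ_; _*_ to _*ℕ_)
import Data.Nat.Properties as ℕP
open import Data.Nat.Divisibility using (divides; ∣1⇒≡1)
open import Data.Nat.DivMod using (_/_; _%_; m≡m%n+[m/n]*n; m%n<n)
open import Data.Nat.Primality using (prime⇒irreducible; ¬prime[1])
import Data.Nat.Tactic.RingSolver as ℕ-Ring
open import Data.Integer using (-[1+_]; _+_; _*_; _-_; _≟_)
import Data.Integer.Properties as ℤP
import Data.Integer.Divisibility as Unsigned
open import Data.Integer.Divisibility.Signed as Signed using (∣ᵤ⇒∣; ∣⇒∣ᵤ)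
open import Data.Integer.Tactic.RingSolver using (solve-∀)
open import Data.List using ([]; _∷_; _++_; replicate)
open import Data.Product using (_,_; proj₁; proj₂)
open import Data.Sum using (inj₁; inj₂)
open import Data.Empty using (⊥-elim)
open import Relation.Binary.PropositionalEquality
  using (_≢_; refl; sym; trans; cong; cong₂; subst; subst₂; module ≡-Reasoning)
open import Relation.Nullary using (Dec; yes; no; ¬_)

mat-cong : ∀ {a b c d a' b' c' d'} →
  a ≡ a' → b ≡ b' → c ≡ c' → d ≡ d' → mat a b c d ≡ mat a' b' c' d'
mat-cong refl refl refl refl = refl

·-assoc : ∀ X Y Z → (X · Y) · Z ≡ X · (Y · Z)
·-assoc (mat a b c d) (mat a' b' c' d') (mat a'' b'' c'' d'') =
  mat-cong (entry a b a' b' c' d' a'' c'') (entry a b a' b' c' d' b'' d'')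
           (entry c d a' b' c' d' a'' c'') (entry c d a' b' c' d' b'' d'')
  where
  entry : ∀ x y a' b' c' d' u v →
    (x * a' + y * c') * u + (x * b' + y * d') * v ≡ x * (a' * u + b' * v) + y * (c' * u + d' * v)
  entry = solve-∀

·-identityˡ : ∀ X → I₂ · X ≡ X
·-identityˡ (mat a b c d) = mat-cong (top a c) (top b d) (bottom a c) (bottom b d)
  where
  top : ∀ x y → + 1 * x + + 0 * y ≡ x
  top = solve-∀
  bottom : ∀ x y → + 0 * x + + 1 * y ≡ y
  bottom = solve-∀

·-identityʳ : ∀ X → X · I₂ ≡ X
·-identityʳ (mat a b c d) = mat-cong (left a b) (right a b) (left c d) (right c d)
  where
  left : ∀ x y → x * + 1 + y * + 0 ≡ x
  left = solve-∀
  right : ∀ x y → x * + 0 + y * + 1 ≡ y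
  right = solve-∀

·-neg : ∀ X Y → X · neg Y ≡ neg (X · Y)
·-neg (mat a b c d) (mat a' b' c' d') =
  mat-cong (entry a b a' c') (entry a b b' d') (entry c d a' c') (entry c d b' d')
  where
  entry : ∀ x y u v → x * (- u) + y * (- v) ≡ - (x * u + y * v)
  entry = solve-∀

det-· : ∀ X Y → det (X · Y) ≡ det X * det Y
det-· (mat a b c d) (mat a' b' c' d') = product a b c d a' b' c' d'
  where
  product : ∀ a b c d a' b' c' d' →
    (a * a' + b * c') * (c * b' + d * d') - (a * b' + b * d') * (c * a' + d * c')
      ≡ (a * d - b * c) * (a' * d' - b' * c')
  product = solve-∀

det-inv : ∀ G → det (inv G) ≡ det G
det-inv (mat a b c d) = adjugate a b c d
  where
  adjugate : ∀ a b c d → d * a - (- b) * (- c) ≡ a * d - b * c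
  adjugate = solve-∀

inv-·ˡ : ∀ G → det G ≡ + 1 → inv G · G ≡ I₂
inv-·ˡ (mat a b c d) det≡1 =
  mat-cong (trans (diag₁ a b c d) det≡1) (off₁ b d) (off₂ a c) (trans (diag₂ a b c d) det≡1)
  where
  diag₁ : ∀ a b c d → d * a + (- b) * c ≡ a * d - b * c
  diag₁ = solve-∀
  diag₂ : ∀ a b c d → (- c) * b + a * d ≡ a * d - b * c
  diag₂ = solve-∀
  off₁ : ∀ b d → d * b + (- b) * d ≡ + 0
  off₁ = solve-∀
  off₂ : ∀ a c → (- c) * a + a * c ≡ + 0
  off₂ = solve-∀

inv-·ʳ : ∀ G → det G ≡ + 1 → G · inv G ≡ I₂
inv-·ʳ (mat a b c d) det≡1 =
  mat-cong (trans (diag₁ a b c d) det≡1) (off₁ a b) (off₂ c d) (trans (diag₂ a b c d) det≡1)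
  where
  diag₁ : ∀ a b c d → a * d + b * (- c) ≡ a * d - b * c
  diag₁ = solve-∀
  diag₂ : ∀ a b c d → c * (- b) + d * a ≡ a * d - b * c
  diag₂ = solve-∀
  off₁ : ∀ a b → a * (- b) + b * a ≡ + 0
  off₁ = solve-∀
  off₂ : ∀ c d → c * d + d * (- c) ≡ + 0
  off₂ = solve-∀

cancelˡ : ∀ G M → det G ≡ + 1 → inv G · (G · M) ≡ M
cancelˡ G M det≡1 = begin
  inv G · (G · M)  ≡⟨ ·-assoc (inv G) G M ⟨
  (inv G · G) · M  ≡⟨ cong (_· M) (inv-·ˡ G det≡1) ⟩
  I₂ · M           ≡⟨ ·-identityˡ M ⟩
  M                ∎
  where open ≡-Reasoning

cancelʳ : ∀ G M → det G ≡ + 1 → G · (inv G · M) ≡ M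
cancelʳ G M det≡1 = begin
  G · (inv G · M)  ≡⟨ ·-assoc G (inv G) M ⟨
  (G · inv G) · M  ≡⟨ cong (_· M) (inv-·ʳ G det≡1) ⟩
  I₂ · M           ≡⟨ ·-identityˡ M ⟩
  M                ∎
  where open ≡-Reasoning

infix 21 T^_
T^_ : ℤ → Mat
T^ k = mat (+ 1) k (+ 0) (+ 1)

T-up : ∀ k → Tm · T^ k ≡ T^ (+ 1 + k)
T-up k = mat-cong refl (top k) refl (corner k)
  where
  top : ∀ k → + 1 * k + + 1 * + 1 ≡ + 1 + k
  top = solve-∀
  corner : ∀ k → + 0 * k + + 1 * + 1 ≡ + 1
  corner = solve-∀

T-down : ∀ k → Tinv · T^ k ≡ T^ (- + 1 + k)
T-down k = mat-cong refl (top k) refl (corner k)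
  where
  top : ∀ k → + 1 * k + (- + 1) * + 1 ≡ - + 1 + k
  top = solve-∀
  corner : ∀ k → + 0 * k + + 1 * + 1 ≡ + 1
  corner = solve-∀

upper-unimodular : ∀ A B D → A * D ≡ + 1 →
  mat A B (+ 0) D ≡ T^ B ⊎ mat A B (+ 0) D ≡ neg (T^ (- B))
upper-unimodular A B D AD≡1 with ℕP.m*n≡1⇒m≡1 ∣ A ∣ ∣ D ∣ (trans (sym (ℤP.abs-* A D)) (cong ∣_∣ AD≡1))
upper-unimodular (+ 1) B D AD≡1 | refl =
  inj₁ (mat-cong refl refl refl (trans (sym (ℤP.*-identityˡ D)) AD≡1))
upper-unimodular -[1+ 0 ] B D AD≡1 | refl =
  inj₂ (mat-cong refl (sym (ℤP.neg-involutive B)) refl D≡-1)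
  where
  D≡-1 : D ≡ - + 1
  D≡-1 = trans (sym (ℤP.neg-involutive D)) (cong -_ (trans (sym (ℤP.-1*i≡-i D)) AD≡1))

-- x = q·y + s with the remainder in [-|y|/2, |y|/2].  The quotient is the
-- integer nearest to x/y with ties broken towards zero, which is what the
-- strict bound on |q| records.
record SymDiv (x y : ℤ) : Set where
  constructor symDiv
  field
    quot rem   : ℤ
    division   : x ≡ quot * y + rem
    rem-small  : 2 *ℕ ∣ rem ∣ ≤ ∣ y ∣
    quot-small : 2 *ℕ (∣ quot ∣ *ℕ ∣ y ∣) < 2 *ℕ ∣ x ∣ +ℕ ∣ y ∣

complement-small : ∀ {t u n} → t +ℕ u ≡ n → n < 2 *ℕ t → 2 *ℕ u < n
complement-small {t} {u} refl n<2t =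
  subst₂ _<_ (sym (double u)) refl (ℕP.+-monoˡ-< u u<t)
  where
  double : ∀ x → 2 *ℕ x ≡ x +ℕ x
  double = ℕ-Ring.solve-∀
  u<t : u < t
  u<t = ℕP.+-cancelˡ-< t u t (subst (t +ℕ u <_) (double t) n<2t)

round-up : ∀ {m n} t q u → m ≡ t +ℕ q *ℕ n → t +ℕ u ≡ n →
  (+ m ≡ + suc q * + n + - + u) × (2 *ℕ (suc q *ℕ n) ≡ 2 *ℕ m +ℕ 2 *ℕ u)
round-up t q u refl refl =
  trans (cong (λ z → + t + z) (ℤP.pos-* q (t +ℕ u))) (in-ℤ (+ t) (+ q) (+ u)) , in-ℕ t q u
  where
  in-ℤ : ∀ t q u → t + q * (t + u) ≡ (+ 1 + q) * (t + u) + - u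
  in-ℤ = solve-∀
  in-ℕ : ∀ t q u → 2 *ℕ (suc q *ℕ (t +ℕ u)) ≡ 2 *ℕ (t +ℕ q *ℕ (t +ℕ u)) +ℕ 2 *ℕ u
  in-ℕ = ℕ-Ring.solve-∀

symDivℕ : ∀ m n .{{_ : NonZero n}} → SymDiv (+ m) (+ n)
symDivℕ m n with m % n | m / n | m≡m%n+[m/n]*n m n | m%n<n m n
... | t | q | m≡t+qn | t<n with 2 *ℕ t ≤? n
...   | yes 2t≤n = symDiv (+ q) (+ t) division 2t≤n bound
  where
  division : + m ≡ + q * + n + + t
  division = trans (cong +_ (trans m≡t+qn (ℕP.+-comm t (q *ℕ n))))
                   (cong (_+ + t) (ℤP.pos-* q n))
  bound : 2 *ℕ (q *ℕ n) < 2 *ℕ m +ℕ n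
  bound = ℕP.≤-<-trans (ℕP.*-monoʳ-≤ 2 (subst (q *ℕ n ≤_) (sym m≡t+qn) (ℕP.m≤n+m (q *ℕ n) t)))
                       (ℕP.m<m+n (2 *ℕ m) (>-nonZero⁻¹ n))
...   | no 2t≰n = symDiv (+ suc q) (- + u) division rem-small bound
  where
  u = n ∸ t
  t+u≡n : t +ℕ u ≡ n
  t+u≡n = ℕP.m+[n∸m]≡n (ℕP.<⇒≤ t<n)
  2u<n : 2 *ℕ u < n
  2u<n = complement-small {t} {u} t+u≡n (ℕP.≰⇒> 2t≰n)
  rem-small : 2 *ℕ ∣ - + u ∣ ≤ n
  rem-small = subst (λ z → 2 *ℕ z ≤ n) (sym (ℤP.∣-i∣≡∣i∣ (+ u))) (ℕP.<⇒≤ 2u<n)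
  division : + m ≡ + suc q * + n + - + u
  division = proj₁ (round-up t q u m≡t+qn t+u≡n)
  bound : 2 *ℕ (suc q *ℕ n) < 2 *ℕ m +ℕ n
  bound = subst (_< 2 *ℕ m +ℕ n) (sym (proj₂ (round-up t q u m≡t+qn t+u≡n)))
                (ℕP.+-monoʳ-< (2 *ℕ m) 2u<n)

SymDiv-negˡ : ∀ {x y} → SymDiv x y → SymDiv (- x) y
SymDiv-negˡ {x} {y} (symDiv q s x≡qy+s rem-small quot-small) =
  symDiv (- q) (- s) (trans (cong -_ x≡qy+s) (negate q y s)) rem-small′ quot-small′
  where
  negate : ∀ q y s → - (q * y + s) ≡ (- q) * y + - s
  negate = solve-∀
  rem-small′ : 2 *ℕ ∣ - s ∣ ≤ ∣ y ∣
  rem-small′ rewrite ℤP.∣-i∣≡∣i∣ s = rem-small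
  quot-small′ : 2 *ℕ (∣ - q ∣ *ℕ ∣ y ∣) < 2 *ℕ ∣ - x ∣ +ℕ ∣ y ∣
  quot-small′ rewrite ℤP.∣-i∣≡∣i∣ q | ℤP.∣-i∣≡∣i∣ x = quot-small

SymDiv-negʳ : ∀ {x y} → SymDiv x y → SymDiv x (- y)
SymDiv-negʳ {x} {y} (symDiv q s x≡qy+s rem-small quot-small) =
  symDiv (- q) s (trans x≡qy+s (negate q y s)) rem-small′ quot-small′
  where
  negate : ∀ q y s → q * y + s ≡ (- q) * (- y) + s
  negate = solve-∀
  rem-small′ : 2 *ℕ ∣ s ∣ ≤ ∣ - y ∣
  rem-small′ rewrite ℤP.∣-i∣≡∣i∣ y = rem-small
  quot-small′ : 2 *ℕ (∣ - q ∣ *ℕ ∣ - y ∣) < 2 *ℕ ∣ x ∣ +ℕ ∣ - y ∣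
  quot-small′ rewrite ℤP.∣-i∣≡∣i∣ q | ℤP.∣-i∣≡∣i∣ y = quot-small

symmetric-division : ∀ x y → 0 < ∣ y ∣ → SymDiv x y
symmetric-division (+ m)    (+ n)    0<n = symDivℕ m n {{>-nonZero 0<n}}
symmetric-division (+ m)    -[1+ n ] _   = SymDiv-negʳ (symDivℕ m (suc n))
symmetric-division -[1+ m ] (+ n)    0<n = SymDiv-negˡ (symDivℕ (suc m) n {{>-nonZero 0<n}})
symmetric-division -[1+ m ] -[1+ n ] _   = SymDiv-negˡ (SymDiv-negʳ (symDivℕ (suc m) (suc n)))

half-smaller : ∀ {σ α} → 0 < α → 2 *ℕ σ ≤ α → σ < α
half-smaller {σ} {α} 0<α 2σ≤α =
  ℕP.*-cancelˡ-< 2 σ α (ℕP.≤-<-trans 2σ≤α (subst (α <_) (sym (double α)) (ℕP.m<m+n α 0<α)))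
  where
  double : ∀ x → 2 *ℕ x ≡ x +ℕ x
  double = ℕ-Ring.solve-∀

-- If 2y ≤ αN and 2ρα < 2y + α, then 2ρ ≤ N.  (Used with y = |CN|, α = |A|
-- and ρ = |r| the symmetric quotient of CN by A.)
quotient-bound : ∀ {y α ρ} N → 2 *ℕ y ≤ α *ℕ N → 2 *ℕ (ρ *ℕ α) < 2 *ℕ y +ℕ α → 2 *ℕ ρ ≤ N
quotient-bound {y} {α} {ρ} N 2y≤αN 2ρα<2y+α =
  ℕP.≤-pred (ℕP.*-cancelʳ-< α (2 *ℕ ρ) (suc N) (begin-strict
  2 *ℕ ρ *ℕ α    ≡⟨ ℕP.*-assoc 2 ρ α ⟩
  2 *ℕ (ρ *ℕ α)  <⟨ 2ρα<2y+α ⟩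
  2 *ℕ y +ℕ α    ≤⟨ ℕP.+-monoˡ-≤ α 2y≤αN ⟩
  α *ℕ N +ℕ α    ≡⟨ regroup α N ⟩
  suc N *ℕ α     ∎))
  where
  open ℕP.≤-Reasoning
  regroup : ∀ α N → α *ℕ N +ℕ α ≡ suc N *ℕ α
  regroup = ℕ-Ring.solve-∀

even-below-prime : ∀ {N ρ} → Prime N → 2 ≤ ρ → 2 *ℕ ρ ≤ N → 2 *ℕ ρ < N
even-below-prime {N} {ρ} N-prime 2≤ρ 2ρ≤N with ℕP.m≤n⇒m<n∨m≡n 2ρ≤N
... | inj₁ 2ρ<N = 2ρ<N
... | inj₂ 2ρ≡N with prime⇒irreducible N-prime (divides ρ (trans (sym 2ρ≡N) (ℕP.*-comm 2 ρ)))
...   | inj₁ ()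
...   | inj₂ 2≡N = ⊥-elim (4≰2 (subst (4 ≤_) (trans 2ρ≡N (sym 2≡N)) (ℕP.*-monoʳ-≤ 2 2≤ρ)))
  where
  4≰2 : ¬ (4 ≤ 2)
  4≰2 (s≤s (s≤s ()))

three-quarters : ∀ {a y σ α} → 0 < α → 2 *ℕ σ ≤ α → y ≤ α +ℕ σ → 2 *ℕ a ≤ y → a < α
three-quarters {a} {y} {σ} {α} 0<α 2σ≤α y≤α+σ 2a≤y =
  ℕP.*-cancelˡ-< 4 a α (begin-strict
    4 *ℕ a              ≡⟨ four a ⟩
    2 *ℕ (2 *ℕ a)       ≤⟨ ℕP.*-monoʳ-≤ 2 2a≤y ⟩
    2 *ℕ y              ≤⟨ ℕP.*-monoʳ-≤ 2 y≤α+σ ⟩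
    2 *ℕ (α +ℕ σ)       ≡⟨ ℕP.*-distribˡ-+ 2 α σ ⟩
    2 *ℕ α +ℕ 2 *ℕ σ    ≤⟨ ℕP.+-monoʳ-≤ (2 *ℕ α) 2σ≤α ⟩
    2 *ℕ α +ℕ α         <⟨ ℕP.+-monoʳ-< (2 *ℕ α) (ℕP.m<m+n α 0<α) ⟩
    2 *ℕ α +ℕ (α +ℕ α)  ≡⟨ four′ α ⟩
    4 *ℕ α              ∎)
  where
  open ℕP.≤-Reasoning
  four : ∀ x → 4 *ℕ x ≡ 2 *ℕ (2 *ℕ x)
  four = ℕ-Ring.solve-∀
  four′ : ∀ x → 2 *ℕ x +ℕ (x +ℕ x) ≡ 4 *ℕ x
  four′ = ℕ-Ring.solve-∀

module Γ₀ (N : ℕ) where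

  -- InΓ₀ uses divisibility of absolute values; the signed notion is
  -- the convenient one for linear combinations.
  signed : ∀ x → + N Unsigned.∣ x → + N Signed.∣ x
  signed x = ∣ᵤ⇒∣ {+ N} {x}

  unsigned : ∀ x → + N Signed.∣ x → + N Unsigned.∣ x
  unsigned x = ∣⇒∣ᵤ {+ N} {x}

  Γ₀-· : ∀ X Y → InΓ₀ N X → InΓ₀ N Y → InΓ₀ N (X · Y)
  Γ₀-· X Y (detX , N∣cX) (detY , N∣cY) =
    trans (det-· X Y) (cong₂ _*_ detX detY) ,
    unsigned (c (X · Y)) (Signed.∣m∣n⇒∣m+n (Signed.∣m⇒∣m*n (a Y) (signed (c X) N∣cX))
                                           (Signed.∣n⇒∣m*n (d X) (signed (c Y) N∣cY)))

  Γ₀-inv : ∀ G → InΓ₀ N G → InΓ₀ N (inv G)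
  Γ₀-inv G (detG , N∣cG) = trans (det-inv G) detG , unsigned (- c G) (Signed.∣m⇒∣-m (signed (c G) N∣cG))

  -- The top-left entry of a matrix in Γ₀(N), N ≠ 1, is non-zero:
  -- otherwise det = -bc would be a multiple of N.
  a-nonzero : N ≢ 1 → ∀ M → InΓ₀ N M → 0 < ∣ a M ∣
  a-nonzero N≢1 (mat A B C D) (detM , N∣C) =
    ℕP.n≢0⇒n>0 (λ ∣A∣≡0 → N≢1 (∣1⇒≡1 (N∣1 (ℤP.∣i∣≡0⇒i≡0 ∣A∣≡0))))
    where
    zero-corner : ∀ B C D → + 0 * D - B * C ≡ - (B * C)
    zero-corner = solve-∀
    N∣1 : A ≡ + 0 → + N Unsigned.∣ + 1
    N∣1 A≡0 = unsigned (+ 1) (subst (+ N Signed.∣_) -BC≡1 (Signed.∣m⇒∣-m (Signed.∣n⇒∣m*n B (signed C N∣C))))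
      where
      -BC≡1 : - (B * C) ≡ + 1
      -BC≡1 = trans (sym (zero-corner B C D)) (trans (cong (λ z → z * D - B * C) (sym A≡0)) detM)

  infix 21 W^_
  W^_ : ℤ → Mat
  W^ k = mat (+ 1) (+ 0) (k * + N) (+ 1)

  W-up : ∀ k → Wm N · W^ k ≡ W^ (+ 1 + k)
  W-up k = mat-cong (diagonal (k * + N)) refl (bottom k (+ N)) (corner (+ N))
    where
    diagonal : ∀ x → + 1 * + 1 + + 0 * x ≡ + 1
    diagonal = solve-∀
    corner : ∀ n → n * + 0 + + 1 * + 1 ≡ + 1
    corner = solve-∀
    bottom : ∀ k n → n * + 1 + + 1 * (k * n) ≡ (+ 1 + k) * n
    bottom = solve-∀

  W-down : ∀ k → Winv N · W^ k ≡ W^ (- + 1 + k)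
  W-down k = mat-cong (diagonal (k * + N)) refl (bottom k (+ N)) (corner (+ N))
    where
    diagonal : ∀ x → + 1 * + 1 + + 0 * x ≡ + 1
    diagonal = solve-∀
    corner : ∀ n → (- n) * + 0 + + 1 * + 1 ≡ + 1
    corner = solve-∀
    bottom : ∀ k n → (- n) * + 1 + + 1 * (k * n) ≡ (- + 1 + k) * n
    bottom = solve-∀

  Γ₀-T : ∀ k → InΓ₀ N (T^ k)
  Γ₀-T k = unipotent k , unsigned (+ 0) (Signed.divides (+ 0) refl)
    where
    unipotent : ∀ k → + 1 * + 1 - k * + 0 ≡ + 1
    unipotent = solve-∀

  Γ₀-W : ∀ k → InΓ₀ N (W^ k)
  Γ₀-W k = unipotent k (+ N) , unsigned (k * + N) (Signed.∣n⇒∣m*n k Signed.∣-refl)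
    where
    unipotent : ∀ k n → + 1 * + 1 - + 0 * (k * n) ≡ + 1
    unipotent = solve-∀

module Words (N : ℕ) (γ : ℤ → Mat) where
  open Γ₀ N using (W^_; W-up; W-down)

  ev : List (Letter N) → Mat
  ev = evalWord N γ

  ev-++ : ∀ u w → ev (u ++ w) ≡ ev u · ev w
  ev-++ [] w = sym (·-identityˡ (ev w))
  ev-++ (τ ∷ u) w = begin
    letterMat N γ τ · ev (u ++ w)       ≡⟨ cong (letterMat N γ τ ·_) (ev-++ u w) ⟩
    letterMat N γ τ · (ev u · ev w)     ≡⟨ ·-assoc (letterMat N γ τ) (ev u) (ev w) ⟨
    (letterMat N γ τ · ev u) · ev w     ∎
    where open ≡-Reasoning

  countγ-++ : ∀ (u w : List (Letter N)) → countγ (u ++ w) ≡ countγ u +ℕ countγ w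
  countγ-++ [] w = refl
  countγ-++ (T⁺ ∷ u) w = countγ-++ u w
  countγ-++ (T⁻ ∷ u) w = countγ-++ u w
  countγ-++ (W⁺ ∷ u) w = countγ-++ u w
  countγ-++ (W⁻ ∷ u) w = countγ-++ u w
  countγ-++ (γ⁻ _ _ ∷ u) w = cong suc (countγ-++ u w)

  Rep : Mat → List (Letter N) → Set
  Rep M w = M ≡ ev w ⊎ M ≡ neg (ev w)

  rep-prefix : ∀ {M M′} u w → M ≡ ev u · M′ → Rep M′ w → Rep M (u ++ w)
  rep-prefix {M} {M′} u w M≡uM′ (inj₁ M′≡w) = inj₁ (begin
    M              ≡⟨ M≡uM′ ⟩
    ev u · M′      ≡⟨ cong (ev u ·_) M′≡w ⟩
    ev u · ev w    ≡⟨ ev-++ u w ⟨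
    ev (u ++ w)    ∎)
    where open ≡-Reasoning
  rep-prefix {M} {M′} u w M≡uM′ (inj₂ M′≡-w) = inj₂ (begin
    M                   ≡⟨ M≡uM′ ⟩
    ev u · M′           ≡⟨ cong (ev u ·_) M′≡-w ⟩
    ev u · neg (ev w)   ≡⟨ ·-neg (ev u) (ev w) ⟩
    neg (ev u · ev w)   ≡⟨ cong neg (ev-++ u w) ⟨
    neg (ev (u ++ w))   ∎)
    where open ≡-Reasoning

  countγ-replicate : ∀ τ → (∀ w → countγ {N} (τ ∷ w) ≡ countγ w) → ∀ n → countγ (replicate n τ) ≡ 0
  countγ-replicate τ plain 0 = refl
  countγ-replicate τ plain (suc n) = trans (plain (replicate n τ)) (countγ-replicate τ plain n)

  module Power (τ⁺ τ⁻ : Letter N) (P : ℤ → Mat) (P-zero : P (+ 0) ≡ I₂)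
    (P-up : ∀ k → letterMat N γ τ⁺ · P k ≡ P (+ 1 + k))
    (P-down : ∀ k → letterMat N γ τ⁻ · P k ≡ P (- + 1 + k))
    (τ⁺-plain : ∀ w → countγ (τ⁺ ∷ w) ≡ countγ w)
    (τ⁻-plain : ∀ w → countγ (τ⁻ ∷ w) ≡ countγ w) where

    pow : ℤ → List (Letter N)
    pow (+ n) = replicate n τ⁺
    pow -[1+ n ] = replicate (suc n) τ⁻

    ev-up : ∀ n → ev (replicate n τ⁺) ≡ P (+ n)
    ev-up 0 = sym P-zero
    ev-up (suc n) = trans (cong (letterMat N γ τ⁺ ·_) (ev-up n)) (P-up (+ n))

    ev-down : ∀ n → ev (replicate n τ⁻) ≡ P (- + n)
    ev-down 0 = sym P-zero
    ev-down (suc n) = trans (cong (letterMat N γ τ⁻ ·_) (ev-down n))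
                            (trans (P-down (- + n)) (cong P (sym (ℤP.neg-distrib-+ (+ 1) (+ n)))))

    ev-pow : ∀ k → ev (pow k) ≡ P k
    ev-pow (+ n) = ev-up n
    ev-pow -[1+ n ] = ev-down (suc n)

    countγ-pow : ∀ k → countγ (pow k) ≡ 0
    countγ-pow (+ n) = countγ-replicate τ⁺ τ⁺-plain n
    countγ-pow -[1+ n ] = countγ-replicate τ⁻ τ⁻-plain (suc n)

  module T-power = Power T⁺ T⁻ T^_ refl T-up T-down (λ _ → refl) (λ _ → refl)
  module W-power = Power W⁺ W⁻ W^_ refl W-up W-down (λ _ → refl) (λ _ → refl)

module Decomposition (N : ℕ) (N-prime : Prime N) (γ : ℤ → Mat)
  (γ-spec : ∀ r → Admissible N r → InΓ₀ N (γ r) × a (γ r) ≡ r × b (γ r) ≡ - (+ 1)) where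

  open Γ₀ N
  open Words N γ

  nonzero : ∀ M → InΓ₀ N M → 0 < ∣ a M ∣
  nonzero = a-nonzero (λ N≡1 → ¬prime[1] (subst Prime N≡1 N-prime))

  Decomposed : Mat → Set
  Decomposed M = ∃[ w ] (Rep M w × 2 ^ countγ w ≤ ∣ a M ∣)

  prefix : ∀ {M M′} u → M ≡ ev u · M′ → 2 ^ countγ u *ℕ ∣ a M′ ∣ ≤ ∣ a M ∣ →
           Decomposed M′ → Decomposed M
  prefix {M} {M′} u M≡uM′ weight (w , rep , bound) = u ++ w , rep-prefix u w M≡uM′ rep , (begin
    2 ^ countγ (u ++ w)            ≡⟨ cong (2 ^_) (countγ-++ u w) ⟩
    2 ^ (countγ u +ℕ countγ w)     ≡⟨ ℕP.^-distribˡ-+-* 2 (countγ u) (countγ w) ⟩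
    2 ^ countγ u *ℕ 2 ^ countγ w   ≤⟨ ℕP.*-monoʳ-≤ (2 ^ countγ u) bound ⟩
    2 ^ countγ u *ℕ ∣ a M′ ∣       ≤⟨ weight ⟩
    ∣ a M ∣                        ∎)
    where open ℕP.≤-Reasoning

  plain-weight : ∀ {M M′} (u : List (Letter N)) → countγ u ≡ 0 →
                 ∣ a M′ ∣ ≤ ∣ a M ∣ → 2 ^ countγ u *ℕ ∣ a M′ ∣ ≤ ∣ a M ∣
  plain-weight {M} {M′} u no-γ A′≤A rewrite no-γ =
    subst (_≤ ∣ a M ∣) (sym (ℕP.*-identityˡ ∣ a M′ ∣)) A′≤A

  upper-triangular : ∀ {M} → InΓ₀ N M → c M ≡ + 0 → Decomposed M
  upper-triangular {mat A B C D} M∈Γ₀@(detM , _) refl =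
    by-sign (upper-unimodular A B D (trans (sym (det-upper A B D)) detM))
    where
    det-upper : ∀ A B D → A * D - B * + 0 ≡ A * D
    det-upper = solve-∀
    bound : ∀ k → 2 ^ countγ (T-power.pow k) ≤ ∣ A ∣
    bound k rewrite T-power.countγ-pow k = nonzero (mat A B (+ 0) D) M∈Γ₀
    by-sign : mat A B (+ 0) D ≡ T^ B ⊎ mat A B (+ 0) D ≡ neg (T^ (- B)) → Decomposed (mat A B (+ 0) D)
    by-sign (inj₁ M≡T^B) =
      T-power.pow B , inj₁ (trans M≡T^B (sym (T-power.ev-pow B))) , bound B
    by-sign (inj₂ M≡-T^-B) =
      T-power.pow (- B) , inj₂ (trans M≡-T^-B (cong neg (sym (T-power.ev-pow (- B))))) , bound (- B)

  -- Left-multiplying by W^{-q} replaces C by its symmetric remainder modulo A: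
  -- M = W^q·M₁ with M₁ in Γ₀(N), the same A, and 2|c M₁| ≤ |A|N.
  record Cleared (M : Mat) : Set where
    field
      power   : ℤ
      next    : Mat
      factor  : M ≡ ev (W-power.pow power) · next
      next∈Γ₀ : InΓ₀ N next
      same-a  : ∣ a next ∣ ≡ ∣ a M ∣
      small-c : 2 *ℕ ∣ c next ∣ ≤ ∣ a next ∣ *ℕ N

  clear-lower-left : ∀ {M} → InΓ₀ N M → Cleared M
  clear-lower-left {M@(mat A B C D)} M∈Γ₀@(_ , N∣C) with signed C N∣C
  ... | Signed.divides C₀ C≡C₀N with symmetric-division C₀ A (nonzero M M∈Γ₀)
  ... | symDiv q C′ C₀≡qA+C′ 2C′≤A _ = record
    { power = q
    ; next = inv (W^ q) · M
    ; factor = trans (sym (cancelʳ (W^ q) M (proj₁ (Γ₀-W q))))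
                     (cong (_· (inv (W^ q) · M)) (sym (W-power.ev-pow q)))
    ; next∈Γ₀ = Γ₀-· (inv (W^ q)) M (Γ₀-inv (W^ q) (Γ₀-W q)) M∈Γ₀
    ; same-a = cong ∣_∣ (top-left A C)
    ; small-c = subst (λ z → 2 *ℕ ∣ c (inv (W^ q) · M) ∣ ≤ ∣ z ∣ *ℕ N) (sym (top-left A C)) bound
    }
    where
    top-left : ∀ A C → + 1 * A + (- + 0) * C ≡ A
    top-left = solve-∀
    remainder : ∀ q A C′ n → (- (q * n)) * A + + 1 * ((q * A + C′) * n) ≡ C′ * n
    remainder = solve-∀
    lower-left : (- (q * + N)) * A + + 1 * C ≡ C′ * + N
    lower-left = trans (cong (λ z → (- (q * + N)) * A + + 1 * z) (trans C≡C₀N (cong (_* + N) C₀≡qA+C′)))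
                       (remainder q A C′ (+ N))
    bound : 2 *ℕ ∣ (- (q * + N)) * A + + 1 * C ∣ ≤ ∣ A ∣ *ℕ N
    bound rewrite lower-left | ℤP.abs-* C′ (+ N) | sym (ℕP.*-assoc 2 ∣ C′ ∣ N) = ℕP.*-monoˡ-≤ N 2C′≤A

  record Descent (M : Mat) : Set where
    field
      word     : List (Letter N)
      next     : Mat
      factor   : M ≡ ev word · next
      next∈Γ₀  : InΓ₀ N next
      shrinks  : ∣ a next ∣ < ∣ a M ∣
      weighted : 2 ^ countγ word *ℕ ∣ a next ∣ ≤ ∣ a M ∣

  γ-descent : ∀ {M} → InΓ₀ N M → ∀ r s → c M ≡ r * a M + s → 2 *ℕ ∣ s ∣ ≤ ∣ a M ∣ →
              Admissible N r → Descent M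
  γ-descent {M} M∈Γ₀ r s Y≡rA+s 2s≤A adm = record
    { word = γ⁻ r adm ∷ []
    ; next = γ r · M
    ; factor = sym factor
    ; next∈Γ₀ = Γ₀-· (γ r) M γ∈Γ₀ M∈Γ₀
    ; shrinks = subst (_< ∣ a M ∣) (sym ∣a-next∣) (half-smaller (nonzero M M∈Γ₀) 2s≤A)
    ; weighted = subst (λ z → 2 *ℕ z ≤ ∣ a M ∣) (sym ∣a-next∣) 2s≤A
    }
    where
    open ≡-Reasoning
    γ∈Γ₀ = proj₁ (γ-spec r adm)
    top-row = proj₂ (γ-spec r adm)
    eliminate : ∀ r A s → r * A + (- + 1) * (r * A + s) ≡ - s
    eliminate = solve-∀
    a-next : a (γ r · M) ≡ - s
    a-next = begin
      a (γ r) * a M + b (γ r) * c M  ≡⟨ cong₂ (λ x y → x * a M + y * c M) (proj₁ top-row) (proj₂ top-row) ⟩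
      r * a M + (- + 1) * c M        ≡⟨ cong (λ z → r * a M + (- + 1) * z) Y≡rA+s ⟩
      r * a M + (- + 1) * (r * a M + s) ≡⟨ eliminate r (a M) s ⟩
      - s                            ∎
    ∣a-next∣ : ∣ a (γ r · M) ∣ ≡ ∣ s ∣
    ∣a-next∣ = trans (cong ∣_∣ a-next) (ℤP.∣-i∣≡∣i∣ s)
    factor : ev (γ⁻ r adm ∷ []) · (γ r · M) ≡ M
    factor = begin
      (inv (γ r) · I₂) · (γ r · M)  ≡⟨ cong (_· (γ r · M)) (·-identityʳ (inv (γ r))) ⟩
      inv (γ r) · (γ r · M)         ≡⟨ cancelˡ (γ r) M (proj₁ γ∈Γ₀) ⟩
      M                             ∎

  -- C·N = r·A + s with |r| ≤ 1: then |CN| ≤ 3|A|/2, and dividing A by CN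
  -- with a power of T leaves a top-left entry of size at most 3|A|/4.
  T-descent : ∀ {M} → InΓ₀ N M → c M ≢ + 0 → ∀ r s → c M ≡ r * a M + s →
              2 *ℕ ∣ s ∣ ≤ ∣ a M ∣ → ∣ r ∣ ≤ 1 → Descent M
  T-descent {M} M∈Γ₀ Y≢0 r s Y≡rA+s 2s≤A r≤1
    with symmetric-division (a M) (c M) (ℕP.n≢0⇒n>0 (λ ∣Y∣≡0 → Y≢0 (ℤP.∣i∣≡0⇒i≡0 ∣Y∣≡0)))
  ... | symDiv j A₂ A≡jY+A₂ 2A₂≤Y _ = record
    { word = T-power.pow j
    ; next = inv (T^ j) · M
    ; factor = trans (sym (cancelʳ (T^ j) M (proj₁ (Γ₀-T j))))
                     (cong (_· (inv (T^ j) · M)) (sym (T-power.ev-pow j)))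
    ; next∈Γ₀ = Γ₀-· (inv (T^ j)) M (Γ₀-inv (T^ j) (Γ₀-T j)) M∈Γ₀
    ; shrinks = A′<A
    ; weighted = plain-weight {M} {inv (T^ j) · M} (T-power.pow j) (T-power.countγ-pow j) (ℕP.<⇒≤ A′<A)
    }
    where
    remainder : ∀ j Y A₂ → + 1 * (j * Y + A₂) + (- j) * Y ≡ A₂
    remainder = solve-∀
    a-next : a (inv (T^ j) · M) ≡ A₂
    a-next = trans (cong (λ z → + 1 * z + (- j) * c M) A≡jY+A₂) (remainder j (c M) A₂)
    ∣Y∣≤∣A∣+∣s∣ : ∣ c M ∣ ≤ ∣ a M ∣ +ℕ ∣ s ∣
    ∣Y∣≤∣A∣+∣s∣ = begin
      ∣ c M ∣                  ≡⟨ cong ∣_∣ Y≡rA+s ⟩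
      ∣ r * a M + s ∣          ≤⟨ ℤP.∣i+j∣≤∣i∣+∣j∣ (r * a M) s ⟩
      ∣ r * a M ∣ +ℕ ∣ s ∣     ≡⟨ cong (_+ℕ ∣ s ∣) (ℤP.abs-* r (a M)) ⟩
      ∣ r ∣ *ℕ ∣ a M ∣ +ℕ ∣ s ∣ ≤⟨ ℕP.+-monoˡ-≤ ∣ s ∣ (ℕP.*-monoˡ-≤ ∣ a M ∣ r≤1) ⟩
      1 *ℕ ∣ a M ∣ +ℕ ∣ s ∣    ≡⟨ cong (_+ℕ ∣ s ∣) (ℕP.*-identityˡ ∣ a M ∣) ⟩
      ∣ a M ∣ +ℕ ∣ s ∣         ∎
      where open ℕP.≤-Reasoning
    A′<A : ∣ a (inv (T^ j) · M) ∣ < ∣ a M ∣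
    A′<A rewrite a-next = three-quarters (nonzero M M∈Γ₀) 2s≤A ∣Y∣≤∣A∣+∣s∣ 2A₂≤Y

  euclid-step : ∀ {M} → InΓ₀ N M → c M ≢ + 0 → 2 *ℕ ∣ c M ∣ ≤ ∣ a M ∣ *ℕ N → Descent M
  euclid-step {M} M∈Γ₀ Y≢0 2Y≤AN with symmetric-division (c M) (a M) (nonzero M M∈Γ₀)
  ... | symDiv r s Y≡rA+s 2s≤A quot-small with 2 ≤? ∣ r ∣
  ...   | yes 2≤r = γ-descent M∈Γ₀ r s Y≡rA+s 2s≤A
                      (2≤r , even-below-prime N-prime 2≤r
                               (quotient-bound {∣ c M ∣} {∣ a M ∣} {∣ r ∣} N 2Y≤AN quot-small))
  ...   | no 2≰r = T-descent M∈Γ₀ Y≢0 r s Y≡rA+s 2s≤A (ℕP.≤-pred (ℕP.≰⇒> 2≰r))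

  decompose : ∀ k M → InΓ₀ N M → ∣ a M ∣ < k → Decomposed M
  decompose (suc k) M M∈Γ₀ A<k+1 =
    prefix {M} {next} (W-power.pow power) factor
      (plain-weight {M} {next} (W-power.pow power) (W-power.countγ-pow power) (ℕP.≤-reflexive same-a))
      (continue (c next ≟ + 0))
    where
    open Cleared (clear-lower-left {M} M∈Γ₀)
    continue : Dec (c next ≡ + 0) → Decomposed next
    continue (yes C≡0) = upper-triangular {next} next∈Γ₀ C≡0
    continue (no C≢0) = prefix {next} {step.next} step.word step.factor step.weighted
      (decompose k step.next step.next∈Γ₀ (ℕP.<-≤-trans step.shrinks (ℕP.≤-pred A<k+1′)))
      where
      module step = Descent (euclid-step {next} next∈Γ₀ C≢0 small-c)
      A<k+1′ : ∣ a next ∣ < suc k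
      A<k+1′ = subst (_< suc k) (sym same-a) A<k+1

lemma4p7 : (N : ℕ) → Prime N →
    (γ : ℤ → Mat) →
    (∀ r → Admissible N r → InΓ₀ N (γ r) × a (γ r) ≡ r × b (γ r) ≡ - (+ 1)) →
    (M : Mat) → InΓ₀ N M →
    ∃[ w ] ((M ≡ evalWord N γ w ⊎ M ≡ neg (evalWord N γ w)) × 2 ^ countγ {N} w ≤ ∣ a M ∣)
lemma4p7 N N-prime γ γ-spec M M∈Γ₀ = decompose (suc ∣ a M ∣) M M∈Γ₀ ℕP.≤-refl
  where open Decomposition N N-prime γ γ-spec
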